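{- Let $U$ be a finite set. A set family $\mathcal{F}\subseteq 2^U$ is a closure difference if and only if it satisfies the interval property: for all $W,T,S\subseteq U$ with $W\subseteq T\subseteq S$ and $W,S\in\mathcal{F}$, also $T\in\mathcal{F}$.
   Context: For $\mathcal{F}\subseteq 2^U$, the upward closure is $\uparrow(\mathcal{F})=\{S\subseteq U:\exists T\in\mathcal{F},\ T\subseteq S\}$. A family $\mathcal{F}$ is a closure difference if there are families $\mathcal{F}_+,\mathcal{F}_-\subseteq 2^U$ with $\mathcal{F}=\uparrow(\mathcal{F}_+)\setminus\uparrow(\mathcal{F}_-)$. -}

module Defs where

open import Data.Nat using (ℕ)
open import Data.Bool using (Bool; true)
open import Data.Fin.Subset using (Subset; _⊆_)
open import Data.Product using (Σ; ∃; _×_)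
open import Relation.Binary.PropositionalEquality using (_≡_)
open import Relation.Nullary using (¬_)

-- The ground set U is Fin n; subsets of U are  Subset n  (= Vec Bool n).
-- A set family F ⊆ 2^U is given by its (Boolean) membership function.
Family : ℕ → Set
Family n = Subset n → Bool

_∈F_ : ∀ {n} → Subset n → Family n → Set
S ∈F F = F S ≡ true

_∈↑_ : ∀ {n} → Subset n → Family n → Set
S ∈↑ F = ∃ λ T → T ∈F F × T ⊆ S

IsClosureDifference : ∀ {n} → Family n → Set
IsClosureDifference {n} F =
  Σ (Family n) λ F₊ → Σ (Family n) λ F₋ →
    ∀ S → (S ∈F F → S ∈↑ F₊ × ¬ (S ∈↑ F₋))
        × (S ∈↑ F₊ × ¬ (S ∈↑ F₋) → S ∈F F)

IntervalProperty : ∀ {n} → Family n → Set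
IntervalProperty F =
  ∀ W T S → W ⊆ T → T ⊆ S → W ∈F F → S ∈F F → T ∈F F

{-# OPTIONS --safe #-}
module Submission where

-- A difference of two upward-closed families is convex: a set squeezed between two members lies
-- above a member of F₊ (below W) and cannot lie above a member of F₋ (that would put S there too).
-- Conversely, a convex F equals ↑F ∖ ↑(↑F ∖ F): no member S of F is above a set T ∈ ↑F ∖ F,
-- since T would then sit between some W ∈ F and S.

open import Defs
open import Data.Nat using (ℕ)
open import Data.Product using (_×_; _,_)
open import Data.Bool using (true)
open import Data.Bool.Properties using (_≟_)
open import Data.Fin.Subset using (Subset; _⊆_)
open import Data.Fin.Subset.Properties using (_⊆?_; anySubset?; ⊆-refl; ⊆-trans)
open import Relation.Nullary using (¬_; Dec; yes; no; does; ¬?; contradiction)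
open import Relation.Nullary.Decidable using (_×-dec_; dec-true)
open import Relation.Binary.PropositionalEquality using (_≡_)

private
  does-true⇒ : ∀ {p} {P : Set p} (P? : Dec P) → does P? ≡ true → P
  does-true⇒ (yes p) _ = p
  does-true⇒ (no _) ()

module _ {n : ℕ} where

  _∈F?_ : (S : Subset n) (F : Family n) → Dec (S ∈F F)
  S ∈F? F = F S ≟ true

  _∈↑?_ : (S : Subset n) (F : Family n) → Dec (S ∈↑ F)
  S ∈↑? F = anySubset? (λ T → (T ∈F? F) ×-dec (T ⊆? S))

  ∈F⇒∈↑ : ∀ {F : Family n} {S} → S ∈F F → S ∈↑ F
  ∈F⇒∈↑ {S = S} S∈F = S , S∈F , ⊆-refl

  ∈↑-upward : ∀ {F : Family n} {S S′} → S ∈↑ F → S ⊆ S′ → S′ ∈↑ F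
  ∈↑-upward (T , T∈F , T⊆S) S⊆S′ = T , T∈F , ⊆-trans T⊆S S⊆S′

  ∉↑-downward : ∀ {F : Family n} {S S′} → ¬ (S′ ∈↑ F) → S ⊆ S′ → ¬ (S ∈↑ F)
  ∉↑-downward S′∉↑F S⊆S′ S∈↑F = S′∉↑F (∈↑-upward S∈↑F S⊆S′)

  ↑-gap : Family n → Family n
  ↑-gap F S = does (¬? (S ∈F? F) ×-dec (S ∈↑? F))

  ∈↑-gap⁻ : ∀ {F : Family n} {S} → S ∈F ↑-gap F → ¬ (S ∈F F) × S ∈↑ F
  ∈↑-gap⁻ {F} {S} = does-true⇒ (¬? (S ∈F? F) ×-dec (S ∈↑? F))

  ∈↑-gap⁺ : ∀ {F : Family n} {S} → ¬ (S ∈F F) → S ∈↑ F → S ∈F ↑-gap F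
  ∈↑-gap⁺ {F} {S} S∉F S∈↑F = dec-true (¬? (S ∈F? F) ×-dec (S ∈↑? F)) (S∉F , S∈↑F)

  closureDifference⇒interval : ∀ {F : Family n} → IsClosureDifference F → IntervalProperty F
  closureDifference⇒interval (F₊ , F₋ , F≐) W T S W⊆T T⊆S W∈F S∈F
    with F≐ W | F≐ S | F≐ T
  ... | W⇒ , _ | S⇒ , _ | _ , ⇒T
    with W⇒ W∈F | S⇒ S∈F
  ... | W∈↑F₊ , _ | _ , S∉↑F₋ = ⇒T (∈↑-upward W∈↑F₊ W⊆T , ∉↑-downward S∉↑F₋ T⊆S)

  interval⇒∉↑gap : ∀ {F : Family n} → IntervalProperty F → ∀ {S} → S ∈F F → ¬ (S ∈↑ ↑-gap F)
  interval⇒∉↑gap convex S∈F (T , T∈gap , T⊆S) with ∈↑-gap⁻ T∈gap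
  ... | T∉F , W , W∈F , W⊆T = T∉F (convex W T _ W⊆T T⊆S W∈F S∈F)

  interval⇒closureDifference : ∀ {F : Family n} → IntervalProperty F → IsClosureDifference F
  interval⇒closureDifference {F} convex = F , ↑-gap F , λ S →
    (λ S∈F → ∈F⇒∈↑ S∈F , interval⇒∉↑gap convex S∈F) , from S
    where
    from : ∀ S → S ∈↑ F × ¬ (S ∈↑ ↑-gap F) → S ∈F F
    from S (S∈↑F , S∉↑gap) with S ∈F? F
    ... | yes S∈F = S∈F
    ... | no S∉F = contradiction (∈F⇒∈↑ (∈↑-gap⁺ S∉F S∈↑F)) S∉↑gap

lemma45 : (n : ℕ) (F : Family n) →
    (IsClosureDifference F → IntervalProperty F) × (IntervalProperty F → IsClosureDifference F)
lemma45 n F = closureDifference⇒interval , interval⇒closureDifference
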